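{- Every rectangular permutation $\pi$ can be expressed uniquely as a composition of the operators $\psi_1,\psi_2,\psi_u,\psi_d$ applied to $e_0$; that is, there is exactly one finite word $w_1\cdots w_m$ over $\{1,2,u,d\}$ such that, setting $\sigma_0=e_0$ and $\sigma_j=\psi_{w_{m-j+1}}(\sigma_{j-1})$ for $1\le j\le m$, each $\sigma_{j-1}$ lies in the domain of $\psi_{w_{m-j+1}}$, and $\sigma_m=\pi$.
   Context: Permutations are in one-line form; $S_0$ consists of the empty permutation $e_0$. A permutation is rectangular if it avoids each of $2413, 2431, 4213, 4231$. For $\pi\in S_n$, $1\le i,j\le n+1$, $\rho_{i,j}(\pi)\in S_{n+1}$ increases by $1$ every entry $\ge i$ and inserts the value $i$ at position $j$. $\psi_1=\rho_{1,1}$ with domain all rectangular permutations; $\psi_2=\rho_{1,2}$ with domain the rectangular $\pi$ of size $\ge2$ with $\pi_1\ne1$; $\psi_u(\pi)=\rho_{\pi_1,1}(\pi)$ with domain the rectangular $\pi$ of size $\ge2$ with $\pi_1\ne1$; $\psi_d(\pi)=\rho_{\pi_1+1,1}(\pi)$ with domain the rectangular $\pi$ of size $\ge1$. -}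

module Defs where

open import Data.Nat using (ℕ; zero; suc; _+_; _∸_; _<_; _≤_; _≥_)
open import Data.List using (List; []; _∷_; length; map; upTo; take; drop; _++_; lookup)
open import Data.List.Relation.Binary.Permutation.Propositional using (_↭_)
open import Data.List.Relation.Binary.Sublist.Propositional using (_⊆_)
open import Data.Fin using (Fin; cast)
open import Data.Product using (Σ; ∃; _×_)
open import Function.Bundles using (_⇔_)
open import Relation.Nullary using (¬_)
open import Relation.Binary.PropositionalEquality using (_≡_)
open import Data.Bool using (if_then_else_)
open import Relation.Nullary.Decidable using (⌊_⌋)
open import Data.Nat using (_≤?_)

-- Permutations in one-line form are lists of naturals; a list of length n
-- is a permutation iff it is a rearrangement of [1, 2, ..., n].
IsPerm : List ℕ → Set
IsPerm xs = xs ↭ map suc (upTo (length xs))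

OrdIso : List ℕ → List ℕ → Set
OrdIso xs ys = Σ (length xs ≡ length ys) λ eq →
  ∀ (i j : Fin (length xs)) →
    (lookup xs i < lookup xs j) ⇔ (lookup ys (cast eq i) < lookup ys (cast eq j))

Contains : List ℕ → List ℕ → Set
Contains π p = ∃ λ s → (s ⊆ π) × OrdIso s p

Avoids : List ℕ → List ℕ → Set
Avoids π p = ¬ Contains π p

Rectangular : List ℕ → Set
Rectangular π = IsPerm π
  × Avoids π (2 ∷ 4 ∷ 1 ∷ 3 ∷ [])
  × Avoids π (2 ∷ 4 ∷ 3 ∷ 1 ∷ [])
  × Avoids π (4 ∷ 2 ∷ 1 ∷ 3 ∷ [])
  × Avoids π (4 ∷ 2 ∷ 3 ∷ 1 ∷ [])

-- ρ_{i,j}: increase every entry ≥ i by 1, insert value i at (1-based) position j.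
ρ : ℕ → ℕ → List ℕ → List ℕ
ρ i j π = take (j ∸ 1) π' ++ i ∷ drop (j ∸ 1) π'
  where
  π' = map (λ x → if ⌊ i ≤? x ⌋ then suc x else x) π

-- First entry π₁ (junk value 0 for the empty permutation; never used there).
first : List ℕ → ℕ
first [] = 0
first (x ∷ _) = x

data Letter : Set where
  one two u d : Letter

ψ : Letter → List ℕ → List ℕ
ψ one π = ρ 1 1 π
ψ two π = ρ 1 2 π
ψ u   π = ρ (first π) 1 π
ψ d   π = ρ (suc (first π)) 1 π

Dom : Letter → List ℕ → Set
Dom one π = Rectangular π
Dom two π = Rectangular π × 2 ≤ length π × ¬ (first π ≡ 1)
Dom u   π = Rectangular π × 2 ≤ length π × ¬ (first π ≡ 1)
Dom d   π = Rectangular π × 1 ≤ length π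

-- Generates (w₁ ∷ … ∷ wₘ) π : applying ψ_{wₘ}, then ψ_{wₘ₋₁}, …, then ψ_{w₁}
-- to e₀ = [] is legal at each step (argument in domain) and yields π.
data Generates : List Letter → List ℕ → Set where
  gen-nil  : Generates [] []
  gen-cons : ∀ {a w σ} → Generates w σ → Dom a σ → Generates (a ∷ w) (ψ a σ)

module Submission where

-- Uniqueness: the first two entries of ψ_a(σ) determine the letter a (ψ₁ starts with 1, ψ_u with
-- an ascent h, h+1, ψ_d with a descent h+1, h, and ψ₂ with none of these but second entry 1), and
-- ψ_a is injective since it is undone by deleting the inserted entry and standardising.
-- Existence: deleting an entry of a rectangular permutation and standardising leaves it
-- rectangular, so it suffices that every rectangular π = h k … has one of these four shapes.
-- Otherwise 1 and h+1 (if h < k) or h−1 (if k < h) occur after k, and together with h and k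
-- they form one of the patterns 2413, 2431, 4213, 4231.

open import Defs
open import Data.Bool using (if_then_else_)
open import Data.Empty using (⊥; ⊥-elim)
import Data.Fin as Fin
open import Data.Fin using (cast)
open import Data.Fin.Properties using (cast-involutive; cast-trans)
open import Data.List using (List; []; _∷_; [_]; _++_; length; lookup; map; upTo)
open import Data.List.Properties
  using (length-map; length-++-sucʳ; map-++; map-∘; map-cong; map-id; map-id-local; upTo-∷ʳ; ∷-injective)
open import Data.List.Membership.Propositional using (_∈_)
open import Data.List.Membership.Propositional.Properties
  using (∈-lookup; ∈-map⁺; ∈-map⁻; ∈-upTo⁺; ∈-upTo⁻; ∈-++⁺ʳ)
open import Data.List.Relation.Unary.All using (All; _∷_; tabulate) renaming (lookup to All-lookup)
import Data.List.Relation.Unary.All as All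
open import Data.List.Relation.Unary.Any using (here; there)
import Data.List.Relation.Unary.Any as Any
open import Data.List.Relation.Unary.Unique.Propositional using (Unique; _∷_)
import Data.List.Relation.Unary.Unique.Propositional.Properties as Unique
open import Data.List.Relation.Binary.Permutation.Propositional
  using (_↭_; ↭-refl; ↭-sym; ↭-trans; ↭⇒↭ₛ; module PermutationReasoning)
open import Data.List.Relation.Binary.Permutation.Propositional.Properties
  using (∈-resp-↭; map⁺; shift; drop-∷; ++⁺ʳ; ++-comm)
open import Data.List.Relation.Binary.Permutation.Setoid.Properties using (Unique-resp-↭)
open import Data.List.Relation.Binary.Sublist.Propositional
  using (_⊆_; []; _∷_; _∷ʳ_; ⊆-refl; ⊆-trans; from∈) renaming (lookup to ⊆-lookup)
import Data.List.Relation.Binary.Sublist.Propositional.Properties as Sublist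
open import Data.Nat using (ℕ; zero; suc; pred; _+_; _<_; _≤_; z≤n; s≤s)
open import Data.Nat.Properties
open import Data.Product using (∃; ∃₂; ∃!; _×_; _,_; proj₁; proj₂)
open import Data.Sum using (_⊎_; inj₁; inj₂; [_,_]′)
import Data.Sum as Sum
open import Function.Base using (_∘_)
open import Function.Bundles using (_⇔_; mk⇔)
import Function.Properties.Equivalence as ⇔
open import Relation.Binary.Core using (_Preserves_⟶_)
open import Relation.Binary.Definitions using (tri<; tri≈; tri>)
open import Relation.Binary.PropositionalEquality
  using (_≡_; _≢_; refl; sym; trans; cong; cong₂; subst; module ≡-Reasoning)
open import Relation.Binary.PropositionalEquality.Properties using (setoid)
open import Relation.Nullary using (yes; no; does)
open import Relation.Nullary.Decidable using (⌊_⌋; dec-true; dec-false)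

-- Written exactly as the relabelling inside ρ, so that ψ a σ unfolds to v ∷ map (bump v) σ
-- (or, for ψ₂, to an insertion after the first entry).
bump : ℕ → ℕ → ℕ
bump v x = if ⌊ v ≤? x ⌋ then suc x else x

unbump : ℕ → ℕ → ℕ
unbump v x = if ⌊ v <? x ⌋ then pred x else x

bump-< : ∀ {v x} → x < v → bump v x ≡ x
bump-< {v} {x} x<v with v ≤? x
... | yes v≤x = ⊥-elim (<⇒≱ x<v v≤x)
... | no _    = refl

bump-≥ : ∀ {v x} → v ≤ x → bump v x ≡ suc x
bump-≥ {v} {x} v≤x with v ≤? x
... | yes _   = refl
... | no v≰x  = ⊥-elim (v≰x v≤x)

unbump-≤ : ∀ {v x} → x ≤ v → unbump v x ≡ x
unbump-≤ {v} {x} x≤v with v <? x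
... | yes v<x = ⊥-elim (<⇒≱ v<x x≤v)
... | no _    = refl

unbump-> : ∀ {v x} → v < x → unbump v x ≡ pred x
unbump-> {v} {x} v<x with v <? x
... | yes _   = refl
... | no v≮x  = ⊥-elim (v≮x v<x)

unbump-bump : ∀ v x → unbump v (bump v x) ≡ x
unbump-bump v x with v ≤? x
... | yes v≤x = unbump-> (s≤s v≤x)
... | no v≰x  = unbump-≤ (<⇒≤ (≰⇒> v≰x))

bump-unbump : ∀ {v x} → x ≢ v → bump v (unbump v x) ≡ x
bump-unbump {v} {x} x≢v with <-cmp v x
bump-unbump {v} {suc x} _ | tri< v<1+x _ _ = trans (cong (bump v) (unbump-> v<1+x)) (bump-≥ (≤-pred v<1+x))
... | tri≈ _ v≡x _ = ⊥-elim (x≢v (sym v≡x))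
... | tri> _ _ x<v = trans (cong (bump v) (unbump-≤ (<⇒≤ x<v))) (bump-< x<v)

map-unbump-bump : ∀ v σ → map (unbump v) (map (bump v) σ) ≡ σ
map-unbump-bump v σ = trans (sym (map-∘ σ)) (trans (map-cong (unbump-bump v) σ) (map-id σ))

<-suc⇒strictlyIncreasing : ∀ {g : ℕ → ℕ} → (∀ x → g x < g (suc x)) → g Preserves _<_ ⟶ _<_
<-suc⇒strictlyIncreasing {g} step {x} {suc y} (s≤s x≤y) with m≤n⇒m<n∨m≡n x≤y
... | inj₁ x<y  = <-trans (<-suc⇒strictlyIncreasing step x<y) (step y)
... | inj₂ refl = step x

strictlyIncreasing⇒<⇔ : ∀ {g : ℕ → ℕ} → g Preserves _<_ ⟶ _<_ → ∀ x y → (x < y) ⇔ (g x < g y)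
strictlyIncreasing⇒<⇔ {g} increasing x y = mk⇔ increasing reflect
  where
  reflect : g x < g y → x < y
  reflect gx<gy with <-cmp x y
  ... | tri< x<y _ _  = x<y
  ... | tri≈ _ refl _ = ⊥-elim (<-irrefl refl gx<gy)
  ... | tri> _ _ y<x  = ⊥-elim (<-asym gx<gy (increasing y<x))

bump-increasing : ∀ v → bump v Preserves _<_ ⟶ _<_
bump-increasing v = <-suc⇒strictlyIncreasing step
  where
  step : ∀ x → bump v x < bump v (suc x)
  step x with v ≤? x | v ≤? suc x
  ... | yes _   | yes _    = ≤-refl
  ... | yes v≤x | no v≰1+x = ⊥-elim (v≰1+x (m≤n⇒m≤1+n v≤x))
  ... | no _    | yes _    = m<n⇒m<1+n ≤-refl
  ... | no _    | no _     = ≤-refl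

<⇔-cong : ∀ {a a′ b b′ : ℕ} → a ≡ a′ → b ≡ b′ → (a < b) ⇔ (a′ < b′)
<⇔-cong refl refl = ⇔.refl

PreservesOrderOn : (ℕ → ℕ) → List ℕ → Set
PreservesOrderOn g t = ∀ {x y} → x ∈ t → y ∈ t → (x < y) ⇔ (g x < g y)

OrdIso-sym : ∀ {xs ys} → OrdIso xs ys → OrdIso ys xs
OrdIso-sym {xs} {ys} (eq , iso) = sym eq , λ i j →
  ⇔.sym (⇔.trans (iso (cast (sym eq) i) (cast (sym eq) j)) (<⇔-cong (cast-back i) (cast-back j)))
  where
  cast-back : ∀ i → lookup ys (cast eq (cast (sym eq) i)) ≡ lookup ys i
  cast-back i = cong (lookup ys) (cast-involutive eq (sym eq) i)

OrdIso-trans : ∀ {xs ys zs} → OrdIso xs ys → OrdIso ys zs → OrdIso xs zs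
OrdIso-trans {zs = zs} (eq₁ , iso₁) (eq₂ , iso₂) = trans eq₁ eq₂ , λ i j →
  ⇔.trans (iso₁ i j) (⇔.trans (iso₂ (cast eq₁ i) (cast eq₁ j)) (<⇔-cong (cast-comp i) (cast-comp j)))
  where
  cast-comp : ∀ i → lookup zs (cast eq₂ (cast eq₁ i)) ≡ lookup zs (cast (trans eq₁ eq₂) i)
  cast-comp i = cong (lookup zs) (cast-trans eq₁ eq₂ i)

lookup-map : ∀ (g : ℕ → ℕ) t i → lookup (map g t) (cast (sym (length-map g t)) i) ≡ g (lookup t i)
lookup-map g (x ∷ t) Fin.zero    = refl
lookup-map g (x ∷ t) (Fin.suc i) = lookup-map g t i

OrdIso-map : ∀ {g t} → PreservesOrderOn g t → OrdIso t (map g t)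
OrdIso-map {g} {t} preserves = sym (length-map g t) , λ i j →
  ⇔.trans (preserves (∈-lookup i) (∈-lookup j)) (<⇔-cong (sym (lookup-map g t i)) (sym (lookup-map g t j)))

oneTo : ℕ → List ℕ
oneTo n = map suc (upTo n)

∈-oneTo⁻ : ∀ {x n} → x ∈ oneTo n → 1 ≤ x × x ≤ n
∈-oneTo⁻ x∈ with ∈-map⁻ suc x∈
... | _ , y∈ , refl = s≤s z≤n , ∈-upTo⁻ y∈

∈-oneTo⁺ : ∀ {x n} → 1 ≤ x → x ≤ n → x ∈ oneTo n
∈-oneTo⁺ {suc _} _ x≤n = ∈-map⁺ suc (∈-upTo⁺ x≤n)

oneTo-suc : ∀ n → oneTo (suc n) ≡ oneTo n ++ [ suc n ]
oneTo-suc n = trans (cong (map suc) (sym (upTo-∷ʳ n))) (map-++ suc (upTo n) [ n ])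

unbump-oneTo : ∀ n {v} → 1 ≤ v → v ≤ suc n → map (unbump v) (oneTo (suc n)) ↭ v ∷ oneTo n
unbump-oneTo zero 1≤v v≤1 with ≤-antisym v≤1 1≤v
... | refl = ↭-refl
unbump-oneTo (suc m) {v} 1≤v v≤2+m with m≤n⇒m<n∨m≡n v≤2+m
... | inj₂ refl = begin
  map (unbump v) (oneTo v)                          ≡⟨ cong (map (unbump v)) (oneTo-suc (suc m)) ⟩
  map (unbump v) (oneTo (suc m) ++ [ v ])           ≡⟨ map-++ (unbump v) (oneTo (suc m)) [ v ] ⟩
  map (unbump v) (oneTo (suc m)) ++ [ unbump v v ]  ≡⟨ cong₂ _++_ (map-id-local (tabulate below))
                                                               (cong [_] (unbump-≤ ≤-refl)) ⟩
  oneTo (suc m) ++ [ v ]                            ↭⟨ ++-comm (oneTo (suc m)) [ v ] ⟩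
  v ∷ oneTo (suc m)                                 ∎
  where
  open PermutationReasoning
  below : ∀ {x} → x ∈ oneTo (suc m) → unbump v x ≡ x
  below x∈ = unbump-≤ (m≤n⇒m≤1+n (proj₂ (∈-oneTo⁻ x∈)))
... | inj₁ (s≤s v≤1+m) = begin
  map (unbump v) (oneTo (suc (suc m)))                         ≡⟨ cong (map (unbump v)) (oneTo-suc (suc m)) ⟩
  map (unbump v) (oneTo (suc m) ++ [ suc (suc m) ])            ≡⟨ map-++ (unbump v) (oneTo (suc m)) [ suc (suc m) ] ⟩
  map (unbump v) (oneTo (suc m)) ++ [ unbump v (suc (suc m)) ] ≡⟨ cong (λ z → map (unbump v) (oneTo (suc m)) ++ [ z ])
                                                                      (unbump-> (s≤s v≤1+m)) ⟩
  map (unbump v) (oneTo (suc m)) ++ [ suc m ]                  ↭⟨ ++⁺ʳ [ suc m ] (unbump-oneTo m 1≤v v≤1+m) ⟩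
  v ∷ oneTo m ++ [ suc m ]                                     ≡⟨ cong (v ∷_) (sym (oneTo-suc m)) ⟩
  v ∷ oneTo (suc m)                                            ∎
  where open PermutationReasoning

IsPerm⇒Unique : ∀ {π} → IsPerm π → Unique π
IsPerm⇒Unique {π} π↭ =
  Unique-resp-↭ (setoid ℕ) (↭⇒↭ₛ (↭-sym π↭)) (Unique.map⁺ suc-injective (Unique.upTo⁺ (length π)))

IsPerm-∈⁻ : ∀ {π x} → IsPerm π → x ∈ π → 1 ≤ x × x ≤ length π
IsPerm-∈⁻ π↭ x∈ = ∈-oneTo⁻ (∈-resp-↭ π↭ x∈)

IsPerm-∈⁺ : ∀ {π x} → IsPerm π → 1 ≤ x → x ≤ length π → x ∈ π
IsPerm-∈⁺ π↭ 1≤x x≤n = ∈-resp-↭ (↭-sym π↭) (∈-oneTo⁺ 1≤x x≤n)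

IsPerm-∈-≤ : ∀ {π x y} → IsPerm π → x ∈ π → 1 ≤ y → y ≤ x → y ∈ π
IsPerm-∈-≤ π↭ x∈ 1≤y y≤x = IsPerm-∈⁺ π↭ 1≤y (≤-trans y≤x (proj₂ (IsPerm-∈⁻ π↭ x∈)))

IsPerm-head-positive : ∀ {h t} → IsPerm (h ∷ t) → 1 ≤ h
IsPerm-head-positive π↭ = proj₁ (IsPerm-∈⁻ π↭ (here refl))

Unique-middle-∉ : ∀ xs (v : ℕ) ys → Unique (xs ++ v ∷ ys) → All (v ≢_) (xs ++ ys)
Unique-middle-∉ xs v ys unique with Unique-resp-↭ (setoid ℕ) (↭⇒↭ₛ (shift v xs ys)) unique
... | v∉ ∷ _ = v∉

IsPerm-delete : ∀ xs v ys → IsPerm (xs ++ v ∷ ys) → IsPerm (map (unbump v) (xs ++ ys))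
IsPerm-delete xs v ys π↭ =
  subst (λ k → map (unbump v) (xs ++ ys) ↭ oneTo k) (sym (length-map (unbump v) (xs ++ ys))) (drop-∷ v∷σ↭)
  where
  n = length (xs ++ ys)
  π↭′ : xs ++ v ∷ ys ↭ oneTo (suc n)
  π↭′ = subst (λ k → xs ++ v ∷ ys ↭ oneTo k) (length-++-sucʳ xs v ys) π↭
  v-bounds : 1 ≤ v × v ≤ suc n
  v-bounds = ∈-oneTo⁻ (∈-resp-↭ π↭′ (∈-++⁺ʳ xs (here refl)))
  v∷σ↭ : v ∷ map (unbump v) (xs ++ ys) ↭ v ∷ oneTo n
  v∷σ↭ = begin
    v ∷ map (unbump v) (xs ++ ys)   ≡⟨ cong (_∷ map (unbump v) (xs ++ ys)) (sym (unbump-≤ ≤-refl)) ⟩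
    map (unbump v) (v ∷ xs ++ ys)   ↭⟨ map⁺ (unbump v) (↭-trans (↭-sym (shift v xs ys)) π↭′) ⟩
    map (unbump v) (oneTo (suc n))  ↭⟨ unbump-oneTo n (proj₁ v-bounds) (proj₂ v-bounds) ⟩
    v ∷ oneTo n                     ∎
    where open PermutationReasoning

⊆-map-inv : ∀ (g : ℕ → ℕ) {s} t → s ⊆ map g t → ∃ λ s′ → s ≡ map g s′ × s′ ⊆ t
⊆-map-inv g [] [] = [] , refl , []
⊆-map-inv g (x ∷ t) (_ ∷ʳ s⊆) with ⊆-map-inv g t s⊆
... | s′ , refl , s′⊆ = s′ , refl , x ∷ʳ s′⊆
⊆-map-inv g (x ∷ t) (refl ∷ s⊆) with ⊆-map-inv g t s⊆
... | s′ , refl , s′⊆ = x ∷ s′ , refl , refl ∷ s′⊆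

Avoids-delete : ∀ xs v ys p → All (v ≢_) (xs ++ ys) →
                Avoids (xs ++ v ∷ ys) p → Avoids (map (unbump v) (xs ++ ys)) p
Avoids-delete xs v ys p v∉ avoids (s , s⊆ , s≅p) with ⊆-map-inv (unbump v) (xs ++ ys) s⊆
... | s′ , refl , s′⊆ =
  avoids (s′ , ⊆-trans s′⊆ (Sublist.++⁺ ⊆-refl (v ∷ʳ ⊆-refl)) ,
          OrdIso-trans {s′} {map (unbump v) s′} {p} (OrdIso-map preserves) s≅p)
  where
  ≢v : ∀ {x} → x ∈ s′ → x ≢ v
  ≢v x∈ x≡v = All-lookup v∉ (⊆-lookup s′⊆ x∈) (sym x≡v)
  preserves : PreservesOrderOn (unbump v) s′
  preserves x∈ y∈ = ⇔.trans (<⇔-cong (sym (bump-unbump (≢v x∈))) (sym (bump-unbump (≢v y∈))))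
                            (⇔.sym (strictlyIncreasing⇒<⇔ (bump-increasing v) _ _))

Rectangular-delete : ∀ xs v ys → Rectangular (xs ++ v ∷ ys) → Rectangular (map (unbump v) (xs ++ ys))
Rectangular-delete xs v ys (π↭ , a₁ , a₂ , a₃ , a₄) =
  IsPerm-delete xs v ys π↭ , avoids a₁ , avoids a₂ , avoids a₃ , avoids a₄
  where
  avoids : ∀ {p} → Avoids (xs ++ v ∷ ys) p → Avoids (map (unbump v) (xs ++ ys)) p
  avoids {p} = Avoids-delete xs v ys p (Unique-middle-∉ xs v ys (IsPerm⇒Unique π↭))

bump-unbump-delete : ∀ xs v ys → Rectangular (xs ++ v ∷ ys) →
                     map (bump v) (map (unbump v) (xs ++ ys)) ≡ xs ++ ys
bump-unbump-delete xs v ys (π↭ , _) =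
  trans (sym (map-∘ (xs ++ ys))) (map-id-local (All.map (λ v≢x → bump-unbump (v≢x ∘ sym)) v∉))
  where v∉ = Unique-middle-∉ xs v ys (IsPerm⇒Unique π↭)

ψ⁻¹ : Letter → List ℕ → List ℕ
ψ⁻¹ two (h ∷ _ ∷ t) = map (unbump 1) (h ∷ t)
ψ⁻¹ two _           = []
ψ⁻¹ _   []          = []
ψ⁻¹ _   (h ∷ t)     = map (unbump h) t

ψ⁻¹-ψ : ∀ a σ → ψ⁻¹ a (ψ a σ) ≡ σ
ψ⁻¹-ψ one σ       = map-unbump-bump 1 σ
ψ⁻¹-ψ two []      = refl
ψ⁻¹-ψ two (x ∷ σ) = map-unbump-bump 1 (x ∷ σ)
ψ⁻¹-ψ u   σ       = map-unbump-bump (first σ) σ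
ψ⁻¹-ψ d   σ       = map-unbump-bump (suc (first σ)) σ

ψ-injective : ∀ a {σ σ′} → ψ a σ ≡ ψ a σ′ → σ ≡ σ′
ψ-injective a {σ} {σ′} eq = trans (sym (ψ⁻¹-ψ a σ)) (trans (cong (ψ⁻¹ a) eq) (ψ⁻¹-ψ a σ′))

ψ-nonempty : ∀ a σ → ψ a σ ≢ []
ψ-nonempty one σ       ()
ψ-nonempty two []      ()
ψ-nonempty two (_ ∷ _) ()
ψ-nonempty u   σ       ()
ψ-nonempty d   σ       ()

letterOf : List ℕ → Letter
letterOf (h ∷ k ∷ _) =
  if does (h ≟ 1) then one
  else if does (k ≟ suc h) then u
  else if does (suc k ≟ h) then d
  else two
letterOf _ = one

letterOf-ψ : ∀ a {σ} → Dom a σ → letterOf (ψ a σ) ≡ a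
letterOf-ψ one {[]}    _ = refl
letterOf-ψ one {_ ∷ _} _ = refl
letterOf-ψ two {_ ∷ []} (_ , s≤s () , _)
letterOf-ψ two {x ∷ _ ∷ _} ((π↭ , _) , _ , x≢1)
  rewrite bump-≥ {1} {x} (IsPerm-head-positive π↭)
        | dec-false (suc x ≟ 1) (>⇒≢ (s≤s (IsPerm-head-positive π↭)))
        | dec-false (2 ≟ suc x) (x≢1 ∘ sym ∘ suc-injective) = refl
letterOf-ψ u {x ∷ _} (_ , _ , x≢1)
  rewrite bump-≥ {x} {x} ≤-refl
        | dec-false (x ≟ 1) x≢1
        | dec-true (suc x ≟ suc x) refl = refl
letterOf-ψ d {x ∷ _} ((π↭ , _) , _)
  rewrite bump-< {suc x} {x} ≤-refl
        | dec-false (suc x ≟ 1) (>⇒≢ (s≤s (IsPerm-head-positive π↭)))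
        | dec-false (x ≟ suc (suc x)) (<⇒≢ (m<n⇒m<1+n ≤-refl))
        | dec-true (suc x ≟ suc x) refl = refl

Generates-injective : ∀ {w w′ π π′} → Generates w π → Generates w′ π′ → π ≡ π′ → w ≡ w′
Generates-injective gen-nil gen-nil _ = refl
Generates-injective gen-nil (gen-cons {a} {σ = σ} _ _) eq = ⊥-elim (ψ-nonempty a σ (sym eq))
Generates-injective (gen-cons {a} {σ = σ} _ _) gen-nil eq = ⊥-elim (ψ-nonempty a σ eq)
Generates-injective (gen-cons {a} g dom) (gen-cons {a′} g′ dom′) eq
  with trans (sym (letterOf-ψ a dom)) (trans (cong letterOf eq) (letterOf-ψ a′ dom′))
... | refl = cong (a ∷_) (Generates-injective g g′ (ψ-injective a eq))

Generates-unique : ∀ {w w′ π} → Generates w π → Generates w′ π → w ≡ w′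
Generates-unique g g′ = Generates-injective g g′ refl

two-∈⇒⊆ : ∀ {x y : ℕ} {t} → x ∈ t → y ∈ t → x ≢ y → (x ∷ y ∷ []) ⊆ t ⊎ (y ∷ x ∷ []) ⊆ t
two-∈⇒⊆ (here refl) (here refl) x≢y = ⊥-elim (x≢y refl)
two-∈⇒⊆ (here refl) (there y∈) _ = inj₁ (refl ∷ from∈ y∈)
two-∈⇒⊆ (there x∈) (here refl) _ = inj₂ (refl ∷ from∈ x∈)
two-∈⇒⊆ {t = z ∷ _} (there x∈) (there y∈) x≢y = Sum.map (z ∷ʳ_) (z ∷ʳ_) (two-∈⇒⊆ x∈ y∈ x≢y)

Contains-map : ∀ {g π p} → g Preserves _<_ ⟶ _<_ → map g p ⊆ π → Contains π p
Contains-map {g} {p = p} increasing gp⊆π =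
  map g p , gp⊆π , OrdIso-sym {p} {map g p} (OrdIso-map {g} {p} (λ _ _ → strictlyIncreasing⇒<⇔ increasing _ _))

-- Sends the pattern values 1, 2, 3, 4 to c₁, c₂, c₃, c₄, so that four entries c_{p₁} … c_{p₄} of a
-- permutation are literally map (stretch c₁ c₂ c₃ c₄) p.
stretch : ℕ → ℕ → ℕ → ℕ → ℕ → ℕ
stretch c₁ c₂ c₃ c₄ 0 = 0
stretch c₁ c₂ c₃ c₄ 1 = c₁
stretch c₁ c₂ c₃ c₄ 2 = c₂
stretch c₁ c₂ c₃ c₄ 3 = c₃
stretch c₁ c₂ c₃ c₄ (suc (suc (suc (suc x)))) = x + c₄

stretch-increasing : ∀ {c₁ c₂ c₃ c₄} → 0 < c₁ → c₁ < c₂ → c₂ < c₃ → c₃ < c₄ →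
                     stretch c₁ c₂ c₃ c₄ Preserves _<_ ⟶ _<_
stretch-increasing {c₁} {c₂} {c₃} {c₄} 0<c₁ c₁<c₂ c₂<c₃ c₃<c₄ = <-suc⇒strictlyIncreasing step
  where
  step : ∀ x → stretch c₁ c₂ c₃ c₄ x < stretch c₁ c₂ c₃ c₄ (suc x)
  step 0 = 0<c₁
  step 1 = c₁<c₂
  step 2 = c₂<c₃
  step 3 = c₃<c₄
  step (suc (suc (suc (suc x)))) = n<1+n (x + c₄)

ascending-gap : ∀ {h k t} → Rectangular (h ∷ k ∷ t) → 1 < h → suc h < k → ⊥
ascending-gap {h} {k} {t} (π↭ , avoid2413 , avoid2431 , _ , _) 1<h 1+h<k =
  [ (λ ⊆t → avoid2413 (Contains-map increasing (refl ∷ refl ∷ ⊆t)))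
  , (λ ⊆t → avoid2431 (Contains-map increasing (refl ∷ refl ∷ ⊆t)))
  ]′ (two-∈⇒⊆ 1∈t 1+h∈t (<⇒≢ (s≤s (<⇒≤ 1<h))))
  where
  increasing = stretch-increasing (s≤s z≤n) 1<h ≤-refl 1+h<k
  h<k = <-trans (n<1+n h) 1+h<k
  1∈t : 1 ∈ t
  1∈t = Any.tail (<⇒≢ (<-trans 1<h h<k)) (Any.tail (<⇒≢ 1<h) (IsPerm-∈-≤ π↭ (here refl) ≤-refl (<⇒≤ 1<h)))
  1+h∈t : suc h ∈ t
  1+h∈t = Any.tail (<⇒≢ 1+h<k) (Any.tail (>⇒≢ ≤-refl)
            (IsPerm-∈-≤ π↭ (there (here refl)) (s≤s z≤n) (<⇒≤ 1+h<k)))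

descending-gap : ∀ {m k t} → Rectangular (suc m ∷ k ∷ t) → 1 < k → k < m → ⊥
descending-gap {m} {k} {t} (π↭ , _ , _ , avoid4213 , avoid4231) 1<k k<m =
  [ (λ ⊆t → avoid4213 (Contains-map increasing (refl ∷ refl ∷ ⊆t)))
  , (λ ⊆t → avoid4231 (Contains-map increasing (refl ∷ refl ∷ ⊆t)))
  ]′ (two-∈⇒⊆ 1∈t m∈t (<⇒≢ 1<m))
  where
  increasing = stretch-increasing (s≤s z≤n) 1<k k<m (n<1+n m)
  1<m = <-trans 1<k k<m
  1∈t : 1 ∈ t
  1∈t = Any.tail (<⇒≢ 1<k) (Any.tail (<⇒≢ (m<n⇒m<1+n 1<m))
          (IsPerm-∈-≤ π↭ (there (here refl)) ≤-refl (<⇒≤ 1<k)))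
  m∈t : m ∈ t
  m∈t = Any.tail (>⇒≢ k<m) (Any.tail (<⇒≢ (n<1+n m)) (IsPerm-∈-≤ π↭ (here refl) (<⇒≤ 1<m) (n≤1+n m)))

rectangular-second : ∀ {h k t} → Rectangular (h ∷ k ∷ t) → h ≢ 1 → k ≢ suc h → suc k ≢ h → k ≡ 1
rectangular-second {h} {k} R@(π↭ , _) h≢1 k≢1+h 1+k≢h with k ≟ 1 | <-cmp h k
... | yes k≡1 | _ = k≡1
... | no _ | tri≈ _ h≡k _ with IsPerm⇒Unique π↭
...   | (h≢k ∷ _) ∷ _ = ⊥-elim (h≢k h≡k)
rectangular-second R@(π↭ , _) h≢1 k≢1+h _ | no _ | tri< h<k _ _ =
  ⊥-elim (ascending-gap R (≤∧≢⇒< (IsPerm-head-positive π↭) (h≢1 ∘ sym)) (≤∧≢⇒< h<k (k≢1+h ∘ sym)))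
rectangular-second {suc m} R@(π↭ , _) _ _ 1+k≢h | no k≢1 | tri> _ _ k<h =
  ⊥-elim (descending-gap R (≤∧≢⇒< (proj₁ (IsPerm-∈⁻ π↭ (there (here refl)))) (k≢1 ∘ sym))
                           (≤∧≢⇒< (≤-pred k<h) (1+k≢h ∘ cong suc)))

Predecessor : List ℕ → Set
Predecessor π = ∃₂ λ a σ → Dom a σ × ψ a σ ≡ π × suc (length σ) ≡ length π

predecessor-one : ∀ {t} → Rectangular (1 ∷ t) → Predecessor (1 ∷ t)
predecessor-one {t} R =
  one , map (unbump 1) t , Rectangular-delete [] 1 t R ,
  cong (1 ∷_) (bump-unbump-delete [] 1 t R) , cong suc (length-map (unbump 1) t)

predecessor-u : ∀ {h t} → Rectangular (h ∷ suc h ∷ t) → h ≢ 1 → Predecessor (h ∷ suc h ∷ t)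
predecessor-u {h} {[]} (π↭ , _) h≢1 =
  ⊥-elim (h≢1 (≤-antisym (≤-pred (proj₂ (IsPerm-∈⁻ π↭ (there (here refl))))) (IsPerm-head-positive π↭)))
predecessor-u {h} {t@(_ ∷ _)} R h≢1 =
  u , σ , (Rectangular-delete [] h (suc h ∷ t) R , s≤s (s≤s z≤n) , h≢1 ∘ trans (sym first≡h)) ,
  ψ≡ , cong suc (length-map (unbump h) (suc h ∷ t))
  where
  σ = map (unbump h) (suc h ∷ t)
  first≡h : first σ ≡ h
  first≡h = unbump-> (n<1+n h)
  ψ≡ : ψ u σ ≡ h ∷ suc h ∷ t
  ψ≡ = begin
    first σ ∷ map (bump (first σ)) σ  ≡⟨ cong (λ v → v ∷ map (bump v) σ) first≡h ⟩
    h ∷ map (bump h) σ                ≡⟨ cong (h ∷_) (bump-unbump-delete [] h (suc h ∷ t) R) ⟩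
    h ∷ suc h ∷ t                     ∎
    where open ≡-Reasoning

predecessor-d : ∀ {k t} → Rectangular (suc k ∷ k ∷ t) → Predecessor (suc k ∷ k ∷ t)
predecessor-d {k} {t} R =
  d , σ , (Rectangular-delete [] (suc k) (k ∷ t) R , s≤s z≤n) ,
  ψ≡ , cong suc (length-map (unbump (suc k)) (k ∷ t))
  where
  σ = map (unbump (suc k)) (k ∷ t)
  first≡k : first σ ≡ k
  first≡k = unbump-≤ (n≤1+n k)
  ψ≡ : ψ d σ ≡ suc k ∷ k ∷ t
  ψ≡ = begin
    suc (first σ) ∷ map (bump (suc (first σ))) σ  ≡⟨ cong (λ v → suc v ∷ map (bump (suc v)) σ) first≡k ⟩
    suc k ∷ map (bump (suc k)) σ                  ≡⟨ cong (suc k ∷_) (bump-unbump-delete [] (suc k) (k ∷ t) R) ⟩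
    suc k ∷ k ∷ t                                 ∎
    where open ≡-Reasoning

predecessor-two : ∀ {h t} → Rectangular (h ∷ 1 ∷ t) → h ≢ 1 → h ≢ 2 → Predecessor (h ∷ 1 ∷ t)
predecessor-two {0} (π↭ , _) _ _ with () ← IsPerm-head-positive π↭
predecessor-two {1} _ h≢1 _ = ⊥-elim (h≢1 refl)
predecessor-two {2} _ _ h≢2 = ⊥-elim (h≢2 refl)
predecessor-two {suc (suc (suc m))} {[]} (π↭ , _) _ _ with s≤s (s≤s ()) ← proj₂ (IsPerm-∈⁻ π↭ (here refl))
predecessor-two {h@(suc (suc (suc m)))} {t@(_ ∷ _)} R _ _ =
  two , σ , (Rectangular-delete [ h ] 1 t R , s≤s (s≤s z≤n) , λ ()) ,
  ψ≡ , cong suc (length-map (unbump 1) (h ∷ t))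
  where
  σ = map (unbump 1) (h ∷ t)
  ψ≡ : ψ two σ ≡ h ∷ 1 ∷ t
  ψ≡ with ∷-injective (bump-unbump-delete [ h ] 1 t R)
  ... | head≡ , tail≡ = cong₂ (λ x xs → x ∷ 1 ∷ xs) head≡ tail≡

predecessor : ∀ {h t} → Rectangular (h ∷ t) → Predecessor (h ∷ t)
predecessor {h} {[]} R@(π↭ , _) with ≤-antisym (proj₂ (IsPerm-∈⁻ π↭ (here refl))) (IsPerm-head-positive π↭)
... | refl = predecessor-one R
predecessor {h} {k ∷ t} R with h ≟ 1 | k ≟ suc h | suc k ≟ h
... | yes refl | _        | _        = predecessor-one R
... | no h≢1   | yes refl | _        = predecessor-u R h≢1
... | no _     | no _     | yes refl = predecessor-d R
... | no h≢1   | no k≢1+h | no 1+k≢h with rectangular-second R h≢1 k≢1+h 1+k≢h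
...   | refl = predecessor-two R h≢1 (1+k≢h ∘ sym)

Dom⇒Rectangular : ∀ a {σ} → Dom a σ → Rectangular σ
Dom⇒Rectangular one dom = dom
Dom⇒Rectangular two dom = proj₁ dom
Dom⇒Rectangular u   dom = proj₁ dom
Dom⇒Rectangular d   dom = proj₁ dom

Generates-exists : ∀ n {π} → length π ≡ n → Rectangular π → ∃ λ w → Generates w π
Generates-exists zero {[]} _ _ = [] , gen-nil
Generates-exists (suc n) {_ ∷ _} |π|≡ R with predecessor R
... | a , σ , dom , ψσ≡π , |σ|≡ with Generates-exists n (suc-injective (trans |σ|≡ |π|≡)) (Dom⇒Rectangular a dom)
...   | w , g = a ∷ w , subst (Generates (a ∷ w)) ψσ≡π (gen-cons g dom)

mainTheorem6 : (π : List ℕ) → Rectangular π → ∃! _≡_ (λ (w : List Letter) → Generates w π)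
mainTheorem6 π R with Generates-exists (length π) refl R
... | w , g = w , g , Generates-unique g
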